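{- Let $K$ be an ap-Kleene algebra, $x\in K$ and $p\in d(K)$. Then $$p+\langle x^\ast\rangle(\langle x\rangle p-p)\le\langle x^\ast\rangle p.$$
   Context: A proto-dioid is a structure $(S,+,\cdot,0,1_\sigma)$ such that $+$ is associative, commutative, idempotent with unit $0$ (order $x\le y\iff x+y=y$), and $1_\sigma\cdot x=x$, $x\cdot 1_\sigma=x$, $x\cdot y+x\cdot z\le x\cdot(y+z)$, $(x+y)\cdot z=x\cdot z+y\cdot z$, $0\cdot x=0$. An ap-dioid is a proto-dioid with unary $a$ such that $x\cdot(y\cdot z)=(x\cdot y)\cdot z$ whenever one of $x,y,z$ equals $a(w)$, and $a(x)\cdot x=0$, $a(x\cdot y)=a(x\cdot a(a(y)))$, $a(x)+a(a(x))=1_\sigma$, $a(x)\cdot(y+z)=a(x)\cdot y+a(x)\cdot z$. An ap-Kleene algebra is an ap-dioid with unary $^\ast$ satisfying $1_\sigma+x\cdot x^\ast\le x^\ast$ and $a(z)+x\cdot y\le y\Rightarrow x^\ast\cdot a(z)\le y$. Set $d(x)=a(a(x))$, $d(K)=\{d(x)\mid x\in K\}$, $\langle x\rangle y=d(x\cdot y)$, and for domain elements $q-p=q\cdot a(p)$ (Boolean difference in the Boolean algebra $d(K)$). -}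

module Defs where

open import Level using (Level; suc)
open import Relation.Binary.PropositionalEquality using (_≡_)
open import Data.Product using (∃)
open import Data.Sum using (_⊎_)

record ApKleeneAlgebra (c : Level) : Set (suc c) where
  infixl 6 _+_
  infixl 7 _·_
  infix 4 _≤_
  field
    Carrier : Set c
    _+_ : Carrier → Carrier → Carrier
    _·_ : Carrier → Carrier → Carrier
    𝟘 : Carrier
    1σ : Carrier
    a : Carrier → Carrier
    _⋆ : Carrier → Carrier

  _≤_ : Carrier → Carrier → Set c
  x ≤ y = x + y ≡ y

  d : Carrier → Carrier
  d x = a (a x)

  IsAnti : Carrier → Set c
  IsAnti x = ∃ λ w → x ≡ a w

  field
    +-assoc : ∀ x y z → (x + y) + z ≡ x + (y + z)
    +-comm : ∀ x y → x + y ≡ y + x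
    +-idem : ∀ x → x + x ≡ x
    +-zero : ∀ x → x + 𝟘 ≡ x
    ·-identityˡ : ∀ x → 1σ · x ≡ x
    ·-identityʳ : ∀ x → x · 1σ ≡ x
    ·-subdistribˡ : ∀ x y z → x · y + x · z ≤ x · (y + z)
    ·-distribʳ : ∀ x y z → (x + y) · z ≡ x · z + y · z
    ·-zeroˡ : ∀ x → 𝟘 · x ≡ 𝟘
    ·-assoc-a : ∀ x y z → IsAnti x ⊎ IsAnti y ⊎ IsAnti z →
                x · (y · z) ≡ (x · y) · z
    a-annihil : ∀ x → a x · x ≡ 𝟘
    a-locality : ∀ x y → a (x · y) ≡ a (x · a (a y))
    a-compl : ∀ x → a x + a (a x) ≡ 1σ
    a-distribˡ : ∀ x y z → a x · (y + z) ≡ a x · y + a x · z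
    ⋆-unfold : ∀ x → 1σ + x · (x ⋆) ≤ x ⋆
    ⋆-induct : ∀ x y z → a z + x · y ≤ y → (x ⋆) · a z ≤ y

  InDom : Carrier → Set c
  InDom p = ∃ λ x → p ≡ d x

  ⟨_⟩_ : Carrier → Carrier → Carrier
  ⟨ x ⟩ y = d (x · y)

  -- Boolean difference on domain elements: q - p = q · a(p)
  _−_ : Carrier → Carrier → Carrier
  q − p = q · a p

-- Write D = ⟨x*⟩p.  The summand p ≤ D because 1 ≤ x*.  For the other summand it
-- suffices that ⟨x*⟩⟨x⟩p ≤ D, an instance of diamond star induction (q ≤ r and
-- ⟨x⟩r ≤ r imply ⟨x*⟩q ≤ r) with q = ⟨x⟩p and r = D: the hypothesis ⟨x⟩D ≤ D is
-- ⟨x·x*⟩p ≤ ⟨x*⟩p by locality.  Diamond star induction itself comes from the star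
-- induction axiom applied to y = r·x*.
module Submission where

open import Defs
open import Level using (Level)
open import Relation.Binary.PropositionalEquality
open import Data.Product using (_,_)
open import Data.Sum using (inj₁; inj₂)

module ApKleeneAlgebraProperties {c : Level} (K : ApKleeneAlgebra c) where
  open ApKleeneAlgebra K
  open ≡-Reasoning

  ≤-trans : ∀ {x y z} → x ≤ y → y ≤ z → x ≤ z
  ≤-trans {x} {y} {z} x≤y y≤z = begin
    x + z       ≡⟨ cong (x +_) (sym y≤z) ⟩
    x + (y + z) ≡⟨ sym (+-assoc x y z) ⟩
    (x + y) + z ≡⟨ cong (_+ z) x≤y ⟩
    y + z       ≡⟨ y≤z ⟩
    z           ∎

  ≤-antisym : ∀ {x y} → x ≤ y → y ≤ x → x ≡ y
  ≤-antisym {x} {y} x≤y y≤x = trans (sym y≤x) (trans (+-comm y x) x≤y)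

  x≤x+y : ∀ x y → x ≤ x + y
  x≤x+y x y = trans (sym (+-assoc x x y)) (cong (_+ y) (+-idem x))

  y≤x+y : ∀ x y → y ≤ x + y
  y≤x+y x y = begin
    y + (x + y) ≡⟨ cong (y +_) (+-comm x y) ⟩
    y + (y + x) ≡⟨ x≤x+y y x ⟩
    y + x       ≡⟨ +-comm y x ⟩
    x + y       ∎

  +-lub : ∀ {x y z} → x ≤ z → y ≤ z → x + y ≤ z
  +-lub {x} {y} {z} x≤z y≤z = trans (+-assoc x y z) (trans (cong (x +_) y≤z) x≤z)

  +-identityˡ : ∀ x → 𝟘 + x ≡ x
  +-identityˡ x = trans (+-comm 𝟘 x) (+-zero x)

  x≤𝟘⇒x≡𝟘 : ∀ {x} → x ≤ 𝟘 → x ≡ 𝟘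
  x≤𝟘⇒x≡𝟘 {x} x≤𝟘 = trans (sym (+-zero x)) x≤𝟘

  -- Only the subdistributive inequality is available on the left, but it suffices.
  ·-monoʳ-≤ : ∀ x {y z} → y ≤ z → x · y ≤ x · z
  ·-monoʳ-≤ x {y} {z} y≤z = ≤-trans (x≤x+y (x · y) (x · z)) xy+xz≤xz
    where
    xy+xz≤xz : x · y + x · z ≤ x · z
    xy+xz≤xz = subst (λ w → x · y + x · z ≤ x · w) y≤z (·-subdistribˡ x y z)

  ·-monoˡ-≤ : ∀ x {y z} → y ≤ z → y · x ≤ z · x
  ·-monoˡ-≤ x {y} {z} y≤z = trans (sym (·-distribʳ y z x)) (cong (_· x) y≤z)

  a≤1σ : ∀ x → a x ≤ 1σ
  a≤1σ x = subst (a x ≤_) (a-compl x) (x≤x+y (a x) (d x))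

  a·y≤y : ∀ x y → a x · y ≤ y
  a·y≤y x y = subst (a x · y ≤_) (·-identityˡ y) (·-monoˡ-≤ y (a≤1σ x))

  y·a≤y : ∀ x y → y · a x ≤ y
  y·a≤y x y = subst (y · a x ≤_) (·-identityʳ y) (·-monoʳ-≤ y (a≤1σ x))

  a1σ≡𝟘 : a 1σ ≡ 𝟘
  a1σ≡𝟘 = trans (sym (·-identityʳ (a 1σ))) (a-annihil 1σ)

  a𝟘≡1σ : a 𝟘 ≡ 1σ
  a𝟘≡1σ = begin
    a 𝟘               ≡⟨ sym (+-identityˡ (a 𝟘)) ⟩
    𝟘 + a 𝟘           ≡⟨ cong (λ v → v + a v) (sym a1σ≡𝟘) ⟩
    a 1σ + a (a 1σ)   ≡⟨ a-compl 1σ ⟩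
    1σ                ∎

  d·x≡x : ∀ x → d x · x ≡ x
  d·x≡x x = begin
    d x · x             ≡⟨ sym (+-identityˡ (d x · x)) ⟩
    𝟘 + d x · x         ≡⟨ cong (_+ d x · x) (sym (a-annihil x)) ⟩
    a x · x + d x · x   ≡⟨ sym (·-distribʳ (a x) (d x) x) ⟩
    (a x + d x) · x     ≡⟨ cong (_· x) (a-compl x) ⟩
    1σ · x              ≡⟨ ·-identityˡ x ⟩
    x                   ∎

  a≡1σ⇒≡𝟘 : ∀ {x} → a x ≡ 1σ → x ≡ 𝟘
  a≡1σ⇒≡𝟘 {x} ax≡1σ = begin
    x         ≡⟨ sym (d·x≡x x) ⟩
    d x · x   ≡⟨ cong (_· x) (trans (cong a ax≡1σ) a1σ≡𝟘) ⟩
    𝟘 · x     ≡⟨ ·-zeroˡ x ⟩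
    𝟘         ∎

  -- Both directions go through locality: a (a x · y) ≡ a (a x · d y).
  a·d≡𝟘⇒a·≡𝟘 : ∀ x y → a x · d y ≡ 𝟘 → a x · y ≡ 𝟘
  a·d≡𝟘⇒a·≡𝟘 x y eq = a≡1σ⇒≡𝟘 (trans (a-locality (a x) y) (trans (cong a eq) a𝟘≡1σ))

  a·≡𝟘⇒a·d≡𝟘 : ∀ x y → a x · y ≡ 𝟘 → a x · d y ≡ 𝟘
  a·≡𝟘⇒a·d≡𝟘 x y eq = a≡1σ⇒≡𝟘 (trans (sym (a-locality (a x) y)) (trans (cong a eq) a𝟘≡1σ))

  a·≡𝟘⇒a≤a : ∀ x y → a x · y ≡ 𝟘 → a x ≤ a y
  a·≡𝟘⇒a≤a x y eq = subst (_≤ a y) (sym ax≡ax·ay) (a·y≤y x (a y))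
    where
    ax≡ax·ay : a x ≡ a x · a y
    ax≡ax·ay = begin
      a x                     ≡⟨ sym (·-identityʳ (a x)) ⟩
      a x · 1σ                ≡⟨ cong (a x ·_) (sym (a-compl y)) ⟩
      a x · (a y + d y)       ≡⟨ a-distribˡ x (a y) (d y) ⟩
      a x · a y + a x · d y   ≡⟨ cong (a x · a y +_) (a·≡𝟘⇒a·d≡𝟘 x y eq) ⟩
      a x · a y + 𝟘           ≡⟨ +-zero (a x · a y) ⟩
      a x · a y               ∎

  a-antitone : ∀ {x y} → x ≤ y → a y ≤ a x
  a-antitone {x} {y} x≤y =
    a·≡𝟘⇒a≤a y x (x≤𝟘⇒x≡𝟘 (subst (a y · x ≤_) (a-annihil y) (·-monoʳ-≤ (a y) x≤y)))

  d-mono : ∀ {x y} → x ≤ y → d x ≤ d y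
  d-mono x≤y = a-antitone (a-antitone x≤y)

  d∘a≡a : ∀ x → d (a x) ≡ a x
  d∘a≡a x = ≤-antisym
    (a·≡𝟘⇒a≤a (d x) x (a·d≡𝟘⇒a·≡𝟘 (d x) x (a-annihil (d x))))
    (a·≡𝟘⇒a≤a x (d x) (a·≡𝟘⇒a·d≡𝟘 x x (a-annihil x)))

  d[a·y]≤a : ∀ x y → d (a x · y) ≤ a x
  d[a·y]≤a x y = subst (d (a x · y) ≤_) (d∘a≡a x) (a-antitone (a·≡𝟘⇒a≤a (a x) (a x · y) dx·ax·y≡𝟘))
    where
    dx·ax·y≡𝟘 : d x · (a x · y) ≡ 𝟘
    dx·ax·y≡𝟘 = begin
      d x · (a x · y)   ≡⟨ ·-assoc-a (d x) (a x) y (inj₁ (a x , refl)) ⟩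
      (d x · a x) · y   ≡⟨ cong (_· y) (a-annihil (a x)) ⟩
      𝟘 · y             ≡⟨ ·-zeroˡ y ⟩
      𝟘                 ∎

  1σ≤x⋆ : ∀ x → 1σ ≤ x ⋆
  1σ≤x⋆ x = ≤-trans (x≤x+y 1σ (x · x ⋆)) (⋆-unfold x)

  x·x⋆≤x⋆ : ∀ x → x · x ⋆ ≤ x ⋆
  x·x⋆≤x⋆ x = ≤-trans (y≤x+y 1σ (x · x ⋆)) (⋆-unfold x)

  x≤x⋆ : ∀ x → x ≤ x ⋆
  x≤x⋆ x = ≤-trans (subst (_≤ x · x ⋆) (·-identityʳ x) (·-monoʳ-≤ x (1σ≤x⋆ x))) (x·x⋆≤x⋆ x)

  ⟨⟩-monoʳ : ∀ x {y z} → y ≤ z → ⟨ x ⟩ y ≤ ⟨ x ⟩ z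
  ⟨⟩-monoʳ x y≤z = d-mono (·-monoʳ-≤ x y≤z)

  ⟨⟩-monoˡ : ∀ {x y} z → x ≤ y → ⟨ x ⟩ z ≤ ⟨ y ⟩ z
  ⟨⟩-monoˡ z x≤y = d-mono (·-monoˡ-≤ z x≤y)

  a≤⟨x⋆⟩a : ∀ x y → a y ≤ ⟨ x ⋆ ⟩ a y
  a≤⟨x⋆⟩a x y = subst (_≤ ⟨ x ⋆ ⟩ a y) (d∘a≡a y)
    (d-mono (subst (_≤ x ⋆ · a y) (·-identityˡ (a y)) (·-monoˡ-≤ (a y) (1σ≤x⋆ x))))

  ⟨⋆⟩-induct : ∀ x y z → a y ≤ a z → ⟨ x ⟩ a z ≤ a z → ⟨ x ⋆ ⟩ a y ≤ a z
  ⟨⋆⟩-induct x y z ay≤az ⟨x⟩az≤az =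
    ≤-trans (d-mono (⋆-induct x (r · x ⋆) y (+-lub ay≤r·x⋆ x·r·x⋆≤r·x⋆))) (d[a·y]≤a z (x ⋆))
    where
    r = a z
    ay≤r·x⋆ : a y ≤ r · x ⋆
    ay≤r·x⋆ = subst (_≤ r · x ⋆) (·-identityʳ (a y))
      (≤-trans (·-monoˡ-≤ 1σ ay≤az) (·-monoʳ-≤ r (1σ≤x⋆ x)))
    d[x·r·x⋆]≤r : d (x · (r · x ⋆)) ≤ r
    d[x·r·x⋆]≤r = subst (_≤ r) (cong a (sym (a-locality x (r · x ⋆))))
      (≤-trans (⟨⟩-monoʳ x (d[a·y]≤a z (x ⋆))) ⟨x⟩az≤az)
    x·r·x⋆≤r·x⋆ : x · (r · x ⋆) ≤ r · x ⋆
    x·r·x⋆≤r·x⋆ = subst (_≤ r · x ⋆) (d·x≡x (x · (r · x ⋆)))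
      (≤-trans (·-monoˡ-≤ (x · (r · x ⋆)) d[x·r·x⋆]≤r)
        (·-monoʳ-≤ r (≤-trans (·-monoʳ-≤ x (a·y≤y z (x ⋆))) (x·x⋆≤x⋆ x))))

  ⟨x⟩⟨x⋆⟩a≤⟨x⋆⟩a : ∀ x y → ⟨ x ⟩ (⟨ x ⋆ ⟩ a y) ≤ ⟨ x ⋆ ⟩ a y
  ⟨x⟩⟨x⋆⟩a≤⟨x⋆⟩a x y = subst (_≤ ⟨ x ⋆ ⟩ a y) ⟨x·x⋆⟩a≡⟨x⟩⟨x⋆⟩a (⟨⟩-monoˡ (a y) (x·x⋆≤x⋆ x))
    where
    ⟨x·x⋆⟩a≡⟨x⟩⟨x⋆⟩a : ⟨ x · x ⋆ ⟩ a y ≡ ⟨ x ⟩ (⟨ x ⋆ ⟩ a y)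
    ⟨x·x⋆⟩a≡⟨x⟩⟨x⋆⟩a = begin
      d ((x · x ⋆) · a y)   ≡⟨ cong d (sym (·-assoc-a x (x ⋆) (a y) (inj₂ (inj₂ (y , refl))))) ⟩
      d (x · (x ⋆ · a y))   ≡⟨ cong a (a-locality x (x ⋆ · a y)) ⟩
      d (x · d (x ⋆ · a y)) ∎

  ⟨x⋆⟩⟨x⟩a≤⟨x⋆⟩a : ∀ x y → ⟨ x ⋆ ⟩ (⟨ x ⟩ a y) ≤ ⟨ x ⋆ ⟩ a y
  ⟨x⋆⟩⟨x⟩a≤⟨x⋆⟩a x y =
    ⟨⋆⟩-induct x (a (x · a y)) (a (x ⋆ · a y)) (⟨⟩-monoˡ (a y) (x≤x⋆ x)) (⟨x⟩⟨x⋆⟩a≤⟨x⋆⟩a x y)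

lemma14p3 : {c : Level} (K : ApKleeneAlgebra c) →
    let open ApKleeneAlgebra K in
      (x p : Carrier) → InDom p →
        p + ⟨ x ⋆ ⟩ ((⟨ x ⟩ p) − p) ≤ ⟨ x ⋆ ⟩ p
lemma14p3 K x p (y , refl) = +-lub (a≤⟨x⋆⟩a x (a y))
  (≤-trans (⟨⟩-monoʳ (x ⋆) (y·a≤y p (⟨ x ⟩ p))) (⟨x⋆⟩⟨x⟩a≤⟨x⋆⟩a x (a y)))
  where
  open ApKleeneAlgebra K
  open ApKleeneAlgebraProperties K
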